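{- Let $M$ be a matroid on a finite linearly ordered ground set $(E,<)$. Let $I$ be an independent set of $M$ and let $C$ be any basis containing $I$. If $B$ is the lexicographically smallest basis containing $I$, then $B\le_{int}C$.
   Context: Lexicographic order on bases: for distinct bases $A,B$, $A<_{lex}B$ iff $\min_<(A\triangle B)\in A$. For $i\in B$, $\mathrm{Cocirc}(B,i)=\{x\in E: B\cup x-i \text{ is a basis}\}$ and $IA(B)=\{i\in B: i=\min\mathrm{Cocirc}(B,i)\}$. The internal order: $A\le_{int}B$ iff $A-IA(A)\subseteq B$ (equivalently, $A$ is the lexicographically smallest basis containing $A\cap B$). -}

module Defs where

open import Data.Nat using (ℕ)
open import Data.Fin using (Fin; _<_)
open import Data.Fin.Subset using (Subset; _∈_; _∉_; _⊆_; _∪_; _-_; ⁅_⁆)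
open import Data.Product using (Σ; _×_; ∃)
open import Relation.Binary.PropositionalEquality using (_≡_; _≢_)
open import Relation.Nullary using (¬_)
open import Function.Bundles using (_⇔_)

-- A matroid on the ground set E = Fin n, linearly ordered by the usual order
-- on Fin n, given by its bases (base axioms: nonempty family, basis exchange).
record Matroid (n : ℕ) : Set₁ where
  field
    IsBasis  : Subset n → Set
    basis-exists : ∃ IsBasis
    exchange : ∀ {A B} → IsBasis A → IsBasis B → ∀ {x} → x ∈ A → x ∉ B →
               Σ (Fin n) λ y → y ∈ B × y ∉ A × IsBasis ((A - x) ∪ ⁅ y ⁆)

-- lexicographic order on subsets of Fin n:
-- A <lex C iff A ≠ C and min (A △ C) ∈ A, i.e. there is m ∈ A - C such that
-- A and C agree on all elements below m.
_<lex_ : ∀ {n} → Subset n → Subset n → Set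
A <lex C = A ≢ C × Σ _ λ m → m ∈ A × m ∉ C × (∀ k → k < m → (k ∈ A ⇔ k ∈ C))

module _ {n : ℕ} (M : Matroid n) where
  open Matroid M

  Independent : Subset n → Set
  Independent I = Σ (Subset n) λ B → IsBasis B × I ⊆ B

  Cocirc : Subset n → Fin n → Fin n → Set
  Cocirc B i x = IsBasis ((B - i) ∪ ⁅ x ⁆)

  IA : Subset n → Fin n → Set
  IA B i = i ∈ B × Cocirc B i i × (∀ x → Cocirc B i x → ¬ (x < i))

  _≤int_ : Subset n → Subset n → Set
  A ≤int B = ∀ j → j ∈ A → ¬ IA A j → j ∈ B

  LexSmallestBasisContaining : Subset n → Subset n → Set
  LexSmallestBasisContaining I B =
    IsBasis B × I ⊆ B × (∀ B′ → IsBasis B′ → I ⊆ B′ → B′ ≢ B → B <lex B′)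

-- Let B be the lexicographically smallest basis containing I and let j ∈ B - I.
-- Exchanging j for some x < j gives a basis B′ that still contains I, so B <lex B′;
-- B and B′ first differ at j, hence x ∈ B and B′ ⊊ B, which is impossible for
-- bases. So j is internally active in B, i.e. B - IA(B) ⊆ I ⊆ C.
module Submission where

open import Defs
open import Data.Nat using (ℕ)
open import Data.Fin using (Fin; _<_; _≟_)
open import Data.Fin.Properties using (<⇒≢)
open import Data.Fin.Subset
open import Data.Fin.Subset.Properties
open import Data.Vec.Base using (_∷_; here; there)
open import Data.Product using (_,_)
open import Data.Sum using (inj₁; inj₂)
open import Data.Empty using (⊥-elim)
open import Relation.Nullary using (¬_; yes; no; contradiction)
open import Relation.Binary.PropositionalEquality using (_≡_; _≢_; refl; sym; subst)
open import Function.Bundles using (Equivalence)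

private
  variable
    n : ℕ
    x y : Fin n
    p : Subset n

x∈p─q⇒x∉q : ∀ (p q : Subset n) → x ∈ p ─ q → x ∉ q
x∈p─q⇒x∉q (s ∷ p) (inside ∷ q) () here
x∈p─q⇒x∉q (s ∷ p) (t ∷ q) (there x∈p─q) (there x∈q) = x∈p─q⇒x∉q p q x∈p─q x∈q

x∈p-y⇒x≢y : ∀ (p : Subset n) → x ∈ p - y → x ≢ y
x∈p-y⇒x≢y {y = y} p x∈p-y refl = x∈p─q⇒x∉q p ⁅ y ⁆ x∈p-y (x∈⁅x⁆ y)

y≢x⇒x∉p-x∪⁅y⁆ : y ≢ x → x ∉ (p - x) ∪ ⁅ y ⁆
y≢x⇒x∉p-x∪⁅y⁆ {p = p} y≢x x∈ with x∈p∪q⁻ (p - _) ⁅ _ ⁆ x∈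
... | inj₁ x∈p-x = x∈p-y⇒x≢y p x∈p-x refl
... | inj₂ x∈⁅y⁆ = y≢x (sym (x∈⁅y⁆⇒x≡y _ x∈⁅y⁆))

x∈p∧x≢y⇒x∈p-y∪⁅z⁆ : ∀ {z} → x ∈ p → x ≢ y → x ∈ (p - y) ∪ ⁅ z ⁆
x∈p∧x≢y⇒x∈p-y∪⁅z⁆ x∈p x≢y = x∈p∪q⁺ (inj₁ (x∈p∧x≢y⇒x∈p-y x∈p x≢y))

y∈p⇒p-x∪⁅y⁆⊆p : y ∈ p → (p - x) ∪ ⁅ y ⁆ ⊆ p
y∈p⇒p-x∪⁅y⁆⊆p {p = p} y∈p z∈ with x∈p∪q⁻ (p - _) ⁅ _ ⁆ z∈
... | inj₁ z∈p-x = p─q⊆p p _ z∈p-x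
... | inj₂ z∈⁅y⁆ = subst (_∈ p) (sym (x∈⁅y⁆⇒x≡y _ z∈⁅y⁆)) y∈p

x∈p⇒p-x∪⁅x⁆≡p : x ∈ p → (p - x) ∪ ⁅ x ⁆ ≡ p
x∈p⇒p-x∪⁅x⁆≡p {x = x} x∈p = ⊆-antisym (y∈p⇒p-x∪⁅y⁆⊆p x∈p) p⊆p-x∪⁅x⁆
  where
  p⊆p-x∪⁅x⁆ : _ ⊆ _
  p⊆p-x∪⁅x⁆ {z} z∈p with z ≟ x
  ... | yes refl = x∈p∪q⁺ (inj₂ (x∈⁅x⁆ x))
  ... | no z≢x   = x∈p∧x≢y⇒x∈p-y∪⁅z⁆ z∈p z≢x

-- The first difference between p and (p - x) ∪ ⁅ y ⁆ can only be at x.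
<lex-p-x∪⁅y⁆∧y<x⇒y∈p : p <lex ((p - x) ∪ ⁅ y ⁆) → y < x → y ∈ p
<lex-p-x∪⁅y⁆∧y<x⇒y∈p {p = p} {x} {y} (_ , m , m∈p , m∉p′ , agree) y<x =
  Equivalence.from (agree y (subst (y <_) (sym m≡x) y<x)) (x∈p∪q⁺ (inj₂ (x∈⁅x⁆ y)))
  where
  m≡x : m ≡ x
  m≡x with m ≟ x
  ... | yes m≡x = m≡x
  ... | no m≢x  = contradiction (x∈p∧x≢y⇒x∈p-y∪⁅z⁆ m∈p m≢x) m∉p′

module _ (M : Matroid n) where
  open Matroid M

  basis⊆basis⇒⊇ : ∀ {A B} → IsBasis A → IsBasis B → A ⊆ B → B ⊆ A
  basis⊆basis⇒⊇ {A} {B} A-basis B-basis A⊆B {x} x∈B with x ∈? A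
  ... | yes x∈A = x∈A
  ... | no x∉A with exchange B-basis A-basis x∈B x∉A
  ...   | y , y∈A , y∉B , _ = contradiction (A⊆B y∈A) y∉B

  lexSmallest∧∉⇒IA : ∀ {I B j} → LexSmallestBasisContaining M I B →
                     j ∈ B → j ∉ I → IA M B j
  lexSmallest∧∉⇒IA {I} {B} {j} (B-basis , I⊆B , B-lexSmallest) j∈B j∉I =
    j∈B , subst IsBasis (sym (x∈p⇒p-x∪⁅x⁆≡p j∈B)) B-basis , no-smaller-exchange
    where
    no-smaller-exchange : ∀ x → Cocirc M B j x → ¬ (x < j)
    no-smaller-exchange x B′-basis x<j =
      j∉B′ (basis⊆basis⇒⊇ B′-basis B-basis B′⊆B j∈B)
      where
      j∉B′ : j ∉ (B - j) ∪ ⁅ x ⁆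
      j∉B′ = y≢x⇒x∉p-x∪⁅y⁆ (<⇒≢ x<j)

      I⊆B′ : I ⊆ (B - j) ∪ ⁅ x ⁆
      I⊆B′ {i} i∈I = x∈p∧x≢y⇒x∈p-y∪⁅z⁆ (I⊆B i∈I) λ { refl → j∉I i∈I }

      B<lexB′ : B <lex ((B - j) ∪ ⁅ x ⁆)
      B<lexB′ = B-lexSmallest _ B′-basis I⊆B′ λ B′≡B → j∉B′ (subst (j ∈_) (sym B′≡B) j∈B)

      B′⊆B : (B - j) ∪ ⁅ x ⁆ ⊆ B
      B′⊆B = y∈p⇒p-x∪⁅y⁆⊆p (<lex-p-x∪⁅y⁆∧y<x⇒y∈p B<lexB′ x<j)

lemma4p5 : ∀ {n : ℕ} (M : Matroid n) (I B C : Subset n) →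
    Independent M I → Matroid.IsBasis M C → I ⊆ C →
    LexSmallestBasisContaining M I B → _≤int_ M B C
lemma4p5 M I B C _ _ I⊆C B-lexSmallest j j∈B j∉IA with j ∈? I
... | yes j∈I = I⊆C j∈I
... | no j∉I  = ⊥-elim (j∉IA (lexSmallest∧∉⇒IA M B-lexSmallest j∈B j∉I))
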